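{- Let $H$ be a finite loopless multigraph containing an XO-gadget with terminals $x,x',y,y'$. Then in every FO2-coloring of $H$, $x$ and $x'$ have the same color, and $y$ and $y'$ have the same color.
   Context: Multigraphs may have parallel edges but no loops. A functional orientation of $H$ is an assignment of directions to a set of edges such that every vertex of positive degree has exactly one edge directed away from it; an edge may be assigned both directions or remain undirected. A 2-coloring is a partition of $V(H)$ into two color classes (not necessarily independent). An FO2-coloring of $H$ is a 2-coloring for which some functional orientation directs every edge whose endpoints have the same color in at least one direction. An EQ-gadget with terminals $u,w$ consists of $u,w$ and seven further private vertices $\gamma,\alpha,\beta,a,b,c,d$ with edges: two parallel edges $u\gamma$, two parallel edges $w\gamma$, single edges $\gamma\alpha,\alpha\beta,\beta\gamma$, two parallel edges $\alpha a$, two parallel edges $\alpha b$, three parallel edges $ab$, two parallel edges $\beta c$, two parallel edges $\beta d$, three parallel edges $cd$. Write $\mathrm{EQ}(u,w)$ for such a gadget. An NE-gadget with terminals $u,w$ consists of vertices $u,p,q,w$, an $\mathrm{EQ}(u,p)$, three parallel edges $pq$, and an $\mathrm{EQ}(q,w)$. Write $\mathrm{NE}(u,w)$. The XO-gadget has twenty distinct vertices $v_1,\dots,v_{20}$, with terminals $x=v_{16}$, $y=v_{19}$, $x'=v_{18}$, $y'=v_{20}$, and consists of: $\mathrm{EQ}(v_1,v_2)$, $\mathrm{EQ}(v_2,v_3)$, $\mathrm{EQ}(v_3,v_4)$, $\mathrm{EQ}(v_4,v_1)$; a cycle $v_5v_6v_7v_8v_9v_{10}v_{11}v_{12}v_5$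 of single edges; $\mathrm{NE}(v_1,v_6)$; $\mathrm{EQ}(v_2,v_{14})$, $\mathrm{EQ}(v_{14},v_8)$; $\mathrm{NE}(v_3,v_{10})$; $\mathrm{EQ}(v_4,v_{13})$, $\mathrm{EQ}(v_{13},v_{12})$; two parallel edges $v_{13}v_5$ and two parallel edges $v_{14}v_9$; $\mathrm{EQ}(v_7,v_{16})$, two parallel edges $v_8v_{16}$, two parallel edges $v_7v_{19}$, $\mathrm{EQ}(v_6,v_{15})$, $\mathrm{EQ}(v_{15},v_{19})$, two parallel edges $v_5v_{15}$; $\mathrm{EQ}(v_{11},v_{18})$, two parallel edges $v_{12}v_{18}$, two parallel edges $v_{11}v_{20}$, $\mathrm{EQ}(v_{10},v_{17})$, $\mathrm{EQ}(v_{17},v_{20})$, two parallel edges $v_9v_{17}$. All sub-gadgets have pairwise disjoint sets of private (non-terminal) vertices, disjoint from $v_1,\dots,v_{20}$. $H$ contains the XO-gadget if all its vertices and edges belong to $H$ and every non-terminal vertex of the gadget (every vertex other than $x,x',y,y'$) is incident in $H$ only to edges of the gadget; the terminals may have further edges in $H$. -}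

module Defs where

open import Data.Nat using (ℕ; zero; suc; _+_; _<ᵇ_)
open import Data.Nat.DivMod using (_mod_)
open import Data.Fin using (Fin; toℕ)
open import Data.Bool using (Bool; true; false; _∧_)
open import Data.List using (List; []; _∷_; _++_; length; lookup; map)
open import Data.Bool.ListAction using (and)
open import Data.Product using (Σ; ∃; _×_; _,_; proj₁; proj₂)
open import Data.Sum using (_⊎_)
open import Relation.Binary.PropositionalEquality using (_≡_; _≢_; refl)
open import Relation.Nullary using (¬_)
open import Function.Definitions using (Injective)

-- Each edge has an (arbitrary, bookkeeping) ordered pair of endpoints.

record Multigraph : Set where
  field
    nV       : ℕ
    nE       : ℕ
    ends     : Fin nE → Fin nV × Fin nV
    loopless : ∀ e → proj₁ (ends e) ≢ proj₂ (ends e)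

open Multigraph public

Incident : (H : Multigraph) → Fin (nV H) → Fin (nE H) → Set
Incident H v e = proj₁ (ends H e) ≡ v ⊎ proj₂ (ends H e) ≡ v

PositiveDegree : (H : Multigraph) → Fin (nV H) → Set
PositiveDegree H v = ∃ λ e → Incident H v e

-- Orientation: each edge gets a subset of the two directions.
-- first component  : directed from proj₁ (ends e) to proj₂ (ends e)
-- second component : directed from proj₂ (ends e) to proj₁ (ends e)
-- (both = bidirected, neither = undirected)

Orientation : Multigraph → Set
Orientation H = Fin (nE H) → Bool × Bool

DirectedAway : (H : Multigraph) → Orientation H → Fin (nV H) → Fin (nE H) → Set
DirectedAway H o v e =
  (proj₁ (ends H e) ≡ v × proj₁ (o e) ≡ true) ⊎
  (proj₂ (ends H e) ≡ v × proj₂ (o e) ≡ true)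

IsFunctionalOrientation : (H : Multigraph) → Orientation H → Set
IsFunctionalOrientation H o =
  ∀ v → PositiveDegree H v →
    Σ (Fin (nE H)) λ e → DirectedAway H o v e × (∀ e' → DirectedAway H o v e' → e' ≡ e)

IsDirected : (H : Multigraph) → Orientation H → Fin (nE H) → Set
IsDirected H o e = proj₁ (o e) ≡ true ⊎ proj₂ (o e) ≡ true

Coloring : Multigraph → Set
Coloring H = Fin (nV H) → Bool

IsFO2Coloring : (H : Multigraph) → Coloring H → Set
IsFO2Coloring H c =
  Σ (Orientation H) λ o → IsFunctionalOrientation H o ×
    (∀ e → c (proj₁ (ends H e)) ≡ c (proj₂ (ends H e)) → IsDirected H o e)

-- The XO-gadget as an explicit list of edges on vertices 0..149.
-- v_i ↦ i - 1 (so v1..v20 are 0..19); private vertices of sub-gadgets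
-- are allocated consecutively from 20 upward, pairwise disjoint.

rep : ℕ → ℕ × ℕ → List (ℕ × ℕ)
rep zero    p = []
rep (suc k) p = p ∷ rep k p

eqE : ℕ → ℕ → ℕ → List (ℕ × ℕ)
eqE u w b =
  let γ = b ; α = b + 1 ; β = b + 2 ; a = b + 3 ; bb = b + 4 ; c = b + 5 ; d = b + 6 in
  rep 2 (u , γ) ++ rep 2 (w , γ) ++
  (γ , α) ∷ (α , β) ∷ (β , γ) ∷ [] ++
  rep 2 (α , a) ++ rep 2 (α , bb) ++ rep 3 (a , bb) ++
  rep 2 (β , c) ++ rep 2 (β , d) ++ rep 3 (c , d)

neE : ℕ → ℕ → ℕ → List (ℕ × ℕ)
neE u w b =
  let p = b ; q = b + 1 in
  eqE u p (b + 2) ++ rep 3 (p , q) ++ eqE q w (b + 9)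

V : ℕ → ℕ
V i = i Data.Nat.∸ 1

eqB : ℕ → ℕ
eqB k = 20 + 7 Data.Nat.* k

neB : ℕ → ℕ
neB j = 118 + 16 Data.Nat.* j

xoEdgesℕ : List (ℕ × ℕ)
xoEdgesℕ =
  eqE (V 1) (V 2) (eqB 0) ++
  eqE (V 2) (V 3) (eqB 1) ++
  eqE (V 3) (V 4) (eqB 2) ++
  eqE (V 4) (V 1) (eqB 3) ++
  (V 5 , V 6) ∷ (V 6 , V 7) ∷ (V 7 , V 8) ∷ (V 8 , V 9) ∷
  (V 9 , V 10) ∷ (V 10 , V 11) ∷ (V 11 , V 12) ∷ (V 12 , V 5) ∷ [] ++
  neE (V 1) (V 6) (neB 0) ++
  eqE (V 2) (V 14) (eqB 4) ++
  eqE (V 14) (V 8) (eqB 5) ++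
  neE (V 3) (V 10) (neB 1) ++
  eqE (V 4) (V 13) (eqB 6) ++
  eqE (V 13) (V 12) (eqB 7) ++
  rep 2 (V 13 , V 5) ++ rep 2 (V 14 , V 9) ++
  eqE (V 7) (V 16) (eqB 8) ++
  rep 2 (V 8 , V 16) ++ rep 2 (V 7 , V 19) ++
  eqE (V 6) (V 15) (eqB 9) ++
  eqE (V 15) (V 19) (eqB 10) ++
  rep 2 (V 5 , V 15) ++
  eqE (V 11) (V 18) (eqB 11) ++
  rep 2 (V 12 , V 18) ++ rep 2 (V 11 , V 20) ++
  eqE (V 10) (V 17) (eqB 12) ++
  eqE (V 17) (V 20) (eqB 13) ++
  rep 2 (V 9 , V 17)

xoNV : ℕ
xoNV = 150

xoNE : ℕ
xoNE = length xoEdgesℕ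

xoNE-is-408 : xoNE ≡ 408
xoNE-is-408 = refl

xo-in-range : and (map (λ p → (proj₁ p <ᵇ 150) ∧ (proj₂ p <ᵇ 150)) xoEdgesℕ) ≡ true
xo-in-range = refl

-- all vertex numbers are < 150 (checked above), so _mod 150 is the identity
xoEnds : Fin xoNE → Fin xoNV × Fin xoNV
xoEnds e = let p = lookup xoEdgesℕ e in (proj₁ p mod 150 , proj₂ p mod 150)

xoX xoY xoX' xoY' : Fin xoNV
xoX  = V 16 mod 150
xoY  = V 19 mod 150
xoX' = V 18 mod 150
xoY' = V 20 mod 150

IsXOTerminal : Fin xoNV → Set
IsXOTerminal v = v ≡ xoX ⊎ v ≡ xoY ⊎ v ≡ xoX' ⊎ v ≡ xoY'

record XOIn (H : Multigraph) : Set where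
  field
    φV      : Fin xoNV → Fin (nV H)
    φE      : Fin xoNE → Fin (nE H)
    φV-inj  : Injective _≡_ _≡_ φV
    φE-inj  : Injective _≡_ _≡_ φE
    φ-ends  : ∀ g → ends H (φE g) ≡ (φV (proj₁ (xoEnds g)) , φV (proj₂ (xoEnds g)))
                  ⊎ ends H (φE g) ≡ (φV (proj₂ (xoEnds g)) , φV (proj₁ (xoEnds g)))
    private-closed : ∀ v → ¬ IsXOTerminal v → ∀ e → Incident H (φV v) e →
                     ∃ λ g → φE g ≡ e

open XOIn public

module Submission where

-- In an FO2-colouring fix the functional orientation.  Only two of its
-- properties matter: every vertex has at most one edge directed away from
-- it, and every monochromatic edge is directed away from one of its ends.
-- From these, local facts about small configurations follow:
--   * an edge neither of whose ends may direct it is bichromatic;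
--   * a monochromatic pair of parallel edges captures the out-edge of
--     both of its ends, so a triple of parallel edges is bichromatic;
--   * a vertex joined by parallel pairs to two differently coloured
--     vertices has its out-edge inside one of these pairs.
-- These give that the terminals of an EQ-gadget have equal colours and
-- those of an NE-gadget different colours; only the presence of the
-- (distinct) gadget edges is used, not that private vertices are closed.  In the XO-gadget this splits
-- the core vertices into the class of v1 and its complement; v19 and v20
-- both lie outside the class, so y and y' agree.  For x and x' it remains
-- to show that v7 and v11 agree: otherwise one of the cycle segments
-- v8 v9 v10 v11 or v12 v5 v6 v7 has no admissible way to direct its
-- monochromatic edge ('blocked-segment').

open import Defs
open import Data.Nat using (ℕ; _+_)
open import Data.Nat.DivMod using (_mod_)
open import Data.Fin using (Fin; #_; _↑ʳ_; _↑ˡ_)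
import Data.Fin as Fin
open import Data.Fin.Properties using (↑ʳ-injective; ↑ˡ-injective)
open import Data.Bool using (Bool; _≟_)
open import Data.Bool.Properties using (¬-not)
open import Data.Vec using (Vec; _∷_; []; lookup; tabulate; map)
open import Data.Vec.Properties using (lookup∘tabulate; lookup-map)
open import Data.Empty using (⊥; ⊥-elim)
open import Data.Product using (_×_; _,_; proj₁; proj₂)
import Data.Product as Product
open import Data.Sum using (_⊎_; inj₁; inj₂; [_,_]; swap)
open import Function using (_∘_)
open import Function.Definitions using (Injective)
open import Relation.Binary.PropositionalEquality
  using (_≡_; _≢_; refl; sym; trans; cong; subst; module ≡-Reasoning)
open import Relation.Nullary using (¬_; yes; no)
open import Relation.Nullary.Decidable using (False; toWitnessFalse; decidable-stable)

both-differ⇒equal : ∀ {x y z : Bool} → x ≢ z → y ≢ z → x ≡ y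
both-differ⇒equal x≢z y≢z = trans (¬-not x≢z) (sym (¬-not y≢z))

one-of-two : ∀ {x y z : Bool} → x ≢ y → z ≡ x ⊎ z ≡ y
one-of-two {x} {y} {z} x≢y with z ≟ x
... | yes z≡x = inj₁ z≡x
... | no  z≢x = inj₂ (both-differ⇒equal z≢x (λ y≡x → x≢y (sym y≡x)))

Joins : (H : Multigraph) → Fin (nE H) → Fin (nV H) → Fin (nV H) → Set
Joins H e p q = ends H e ≡ (p , q) ⊎ ends H e ≡ (q , p)

JoinsPair : (H : Multigraph) → Fin (nE H) → Fin (nV H) × Fin (nV H) → Set
JoinsPair H e (p , q) = Joins H e p q

record Parallel (H : Multigraph) (p q : Fin (nV H)) : Set where
  constructor parallel
  field
    first second : Fin (nE H)
    joins-first  : Joins H first p q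
    joins-second : Joins H second p q
    distinct     : first ≢ second

parallel-sym : ∀ {H p q} → Parallel H p q → Parallel H q p
parallel-sym (parallel e₁ e₂ j₁ j₂ e₁≢e₂) = parallel e₁ e₂ (swap j₁) (swap j₂) e₁≢e₂

record Triple (H : Multigraph) (p q : Fin (nV H)) : Set where
  constructor triple
  field
    pair          : Parallel H p q
    third         : Fin (nE H)
    joins-third   : Joins H third p q
    third≢first   : third ≢ Parallel.first pair
    third≢second  : third ≢ Parallel.second pair

-- The 21 edges of EQ(u,w), in the order of the definition of the gadget
-- (whose private vertices a, b, c, d are called a₁, a₂, b₁, b₂ here).
eqEdges : {A : Set} (u w γ α β a₁ a₂ b₁ b₂ : A) → Vec (A × A) 21
eqEdges u w γ α β a₁ a₂ b₁ b₂ =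
  (u , γ) ∷ (u , γ) ∷ (w , γ) ∷ (w , γ) ∷ (γ , α) ∷ (α , β) ∷ (β , γ) ∷
  (α , a₁) ∷ (α , a₁) ∷ (α , a₂) ∷ (α , a₂) ∷ (a₁ , a₂) ∷ (a₁ , a₂) ∷ (a₁ , a₂) ∷
  (β , b₁) ∷ (β , b₁) ∷ (β , b₂) ∷ (β , b₂) ∷ (b₁ , b₂) ∷ (b₁ , b₂) ∷ (b₁ , b₂) ∷ []

-- An EQ-gadget with terminals u, w: 21 distinct edges of H realising
-- 'eqEdges'.  Nothing beyond the presence of these edges is needed.
record EQGadget (H : Multigraph) (u w : Fin (nV H)) : Set where
  field
    γ α β a₁ a₂ b₁ b₂ : Fin (nV H)
    edge              : Fin 21 → Fin (nE H)
    edge-injective    : Injective _≡_ _≡_ edge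
    edge-joins        : ∀ t → JoinsPair H (edge t) (lookup (eqEdges u w γ α β a₁ a₂ b₁ b₂) t)

data NEGadget (H : Multigraph) (u w : Fin (nV H)) : Set where
  ne : ∀ {p q} → EQGadget H u p → Triple H p q → EQGadget H q w → NEGadget H u w

directed⇒incident : ∀ {H o v e} → DirectedAway H o v e → Incident H v e
directed⇒incident (inj₁ (end≡v , _)) = inj₁ end≡v
directed⇒incident (inj₂ (end≡v , _)) = inj₂ end≡v

functional⇒out-unique : (H : Multigraph) (o : Orientation H) → IsFunctionalOrientation H o →
  ∀ {v e e'} → DirectedAway H o v e → DirectedAway H o v e' → e ≡ e'
functional⇒out-unique H o functional {v} {e} {e'} out out'
  with functional v (e , directed⇒incident {H} {o} out)
... | _ , _ , unique = trans (unique e out) (sym (unique e' out'))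

module Colouring (H : Multigraph) (c : Coloring H) (o : Orientation H)
  (out-unique : ∀ {v e e'} → DirectedAway H o v e → DirectedAway H o v e' → e ≡ e')
  (mono-directed : ∀ e → c (proj₁ (ends H e)) ≡ c (proj₂ (ends H e)) → IsDirected H o e)
  where

  Out : Fin (nV H) → Fin (nE H) → Set
  Out = DirectedAway H o

  OutAmong : Fin (nV H) → Fin (nE H) → Fin (nE H) → Set
  OutAmong v e₁ e₂ = Out v e₁ ⊎ Out v e₂

  monochromatic-out : ∀ {e p q} → Joins H e p q → c p ≡ c q → Out p e ⊎ Out q e
  monochromatic-out (inj₁ ends≡pq) cp≡cq = directed-out ends≡pq cp≡cq
    where
    directed-out : ∀ {e p q} → ends H e ≡ (p , q) → c p ≡ c q → Out p e ⊎ Out q e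
    directed-out {e} ends≡ cp≡cq
      with mono-directed e (subst (λ pq → c (proj₁ pq) ≡ c (proj₂ pq)) (sym ends≡) cp≡cq)
    ... | inj₁ forward  = inj₁ (inj₁ (cong proj₁ ends≡ , forward))
    ... | inj₂ backward = inj₂ (inj₂ (cong proj₂ ends≡ , backward))
  monochromatic-out (inj₂ ends≡qp) cp≡cq = swap (monochromatic-out (inj₁ ends≡qp) (sym cp≡cq))

  avoids : ∀ {v e₁ e₂ h} → OutAmong v e₁ e₂ → h ≢ e₁ → h ≢ e₂ → ¬ Out v h
  avoids (inj₁ out₁) h≢e₁ _ out = h≢e₁ (out-unique out out₁)
  avoids (inj₂ out₂) _ h≢e₂ out = h≢e₂ (out-unique out out₂)

  avoids₂ : ∀ {v e₁ e₂ f₁ f₂ h} → OutAmong v e₁ e₂ ⊎ OutAmong v f₁ f₂ →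
    h ≢ e₁ → h ≢ e₂ → h ≢ f₁ → h ≢ f₂ → ¬ Out v h
  avoids₂ (inj₁ among) h≢e₁ h≢e₂ _ _ = avoids among h≢e₁ h≢e₂
  avoids₂ (inj₂ among) _ _ h≢f₁ h≢f₂ = avoids among h≢f₁ h≢f₂

  blocked-bichromatic : ∀ {e p q} → Joins H e p q → ¬ Out p e → ¬ Out q e → c p ≢ c q
  blocked-bichromatic joins ¬out-p ¬out-q cp≡cq = [ ¬out-p , ¬out-q ] (monochromatic-out joins cp≡cq)

  forced-out : ∀ {e p q} → Joins H e p q → c p ≡ c q → ¬ Out q e → Out p e
  forced-out joins cp≡cq ¬out-q with monochromatic-out joins cp≡cq
  ... | inj₁ out-p = out-p
  ... | inj₂ out-q = ⊥-elim (¬out-q out-q)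

  parallel-monochromatic : ∀ {p q} (P : Parallel H p q) → c p ≡ c q →
    OutAmong p (Parallel.first P) (Parallel.second P) × OutAmong q (Parallel.first P) (Parallel.second P)
  parallel-monochromatic (parallel _ _ j₁ j₂ e₁≢e₂) cp≡cq
    with monochromatic-out j₁ cp≡cq | monochromatic-out j₂ cp≡cq
  ... | inj₁ out₁ | inj₁ out₂ = ⊥-elim (e₁≢e₂ (out-unique out₁ out₂))
  ... | inj₂ out₁ | inj₂ out₂ = ⊥-elim (e₁≢e₂ (out-unique out₁ out₂))
  ... | inj₁ out-p | inj₂ out-q = inj₁ out-p , inj₂ out-q
  ... | inj₂ out-q | inj₁ out-p = inj₂ out-p , inj₁ out-q

  -- Three parallel edges cannot all be absorbed: their ends differ in colour.
  triple-bichromatic : ∀ {p q} → Triple H p q → c p ≢ c q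
  triple-bichromatic (triple P _ j₃ e₃≢e₁ e₃≢e₂) cp≡cq
    with parallel-monochromatic P cp≡cq | monochromatic-out j₃ cp≡cq
  ... | among-p , _ | inj₁ out-p = avoids among-p e₃≢e₁ e₃≢e₂ out-p
  ... | _ , among-q | inj₂ out-q = avoids among-q e₃≢e₁ e₃≢e₂ out-q

  -- A vertex joined by parallel pairs to two differently coloured vertices
  -- has the same colour as one of them, hence its out-edge in that pair.
  attached-between : ∀ {m s t} (P : Parallel H m s) (Q : Parallel H m t) → c s ≢ c t →
    OutAmong m (Parallel.first P) (Parallel.second P) ⊎ OutAmong m (Parallel.first Q) (Parallel.second Q)
  attached-between P Q cs≢ct with one-of-two {z = c _} cs≢ct
  ... | inj₁ cm≡cs = inj₁ (proj₁ (parallel-monochromatic P cm≡cs))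
  ... | inj₂ cm≡ct = inj₂ (proj₁ (parallel-monochromatic Q cm≡ct))

  -- A path p m q r with c p ≢ c q and c q ≡ c r cannot exist when p, m, r
  -- are barred from the path edges: m's colour makes pm or mq monochromatic,
  -- and q's only out-edge is qr.
  blocked-segment : ∀ {p m q r e₁ e₂ e₃} → c p ≢ c q → c q ≡ c r →
    Joins H e₁ p m → Joins H e₂ m q → Joins H e₃ q r → e₂ ≢ e₃ →
    ¬ Out p e₁ → ¬ Out m e₁ → ¬ Out m e₂ → ¬ Out r e₃ → ⊥
  blocked-segment {p} {m} {q} {r} {e₁} {e₂} cp≢cq cq≡cr j₁ j₂ j₃ e₂≢e₃ ¬out-p ¬out-m₁ ¬out-m₂ ¬out-r =
    cp≢cq (both-differ⇒equal (λ cp≡cm → m≢p (sym cp≡cm)) q≢m)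
    where
    ¬out-q : ¬ Out q e₂
    ¬out-q out = e₂≢e₃ (out-unique out (forced-out j₃ cq≡cr ¬out-r))
    m≢p : c m ≢ c p
    m≢p = blocked-bichromatic (swap j₁) ¬out-m₁ ¬out-p
    q≢m : c q ≢ c m
    q≢m = blocked-bichromatic (swap j₂) ¬out-q ¬out-m₂

  -- EQ-gadget: a, b and c, d are joined by triples, so α and β are each
  -- attached to two colours and may not direct γα, αβ, βγ.  Hence αβ is
  -- bichromatic and γ directs γα or βγ; a monochromatic pair uγ (or wγ)
  -- would capture that out-edge, so u and w both differ from γ.
  eq-same-colour : ∀ {u w} → EQGadget H u w → c u ≡ c w
  eq-same-colour {u} {w} g = both-differ⇒equal u≢γ w≢γ
    where
    open EQGadget g
    edge≢ : ∀ {s t} {s≢t : False (s Fin.≟ t)} → edge s ≢ edge t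
    edge≢ {s≢t = s≢t} = toWitnessFalse s≢t ∘ edge-injective
    pair : ∀ s t {s≢t : False (s Fin.≟ t)} → let (p , q) = lookup (eqEdges u w γ α β a₁ a₂ b₁ b₂) s in
      JoinsPair H (edge t) (p , q) → Parallel H p q
    pair s t {s≢t} joins-t = parallel (edge s) (edge t) (edge-joins s) joins-t (edge≢ {s≢t = s≢t})
    uγ : Parallel H u γ
    uγ = pair (# 0) (# 1) (edge-joins (# 1))
    wγ : Parallel H w γ
    wγ = pair (# 2) (# 3) (edge-joins (# 3))
    αa₁ : Parallel H α a₁
    αa₁ = pair (# 7) (# 8) (edge-joins (# 8))
    αa₂ : Parallel H α a₂
    αa₂ = pair (# 9) (# 10) (edge-joins (# 10))
    βb₁ : Parallel H β b₁
    βb₁ = pair (# 14) (# 15) (edge-joins (# 15))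
    βb₂ : Parallel H β b₂
    βb₂ = pair (# 16) (# 17) (edge-joins (# 17))
    a₁≢a₂ : c a₁ ≢ c a₂
    a₁≢a₂ = triple-bichromatic (triple (pair (# 11) (# 12) (edge-joins (# 12))) (edge (# 13)) (edge-joins (# 13)) edge≢ edge≢)
    b₁≢b₂ : c b₁ ≢ c b₂
    b₁≢b₂ = triple-bichromatic (triple (pair (# 18) (# 19) (edge-joins (# 19))) (edge (# 20)) (edge-joins (# 20)) edge≢ edge≢)
    α-out : OutAmong α (edge (# 7)) (edge (# 8)) ⊎ OutAmong α (edge (# 9)) (edge (# 10))
    α-out = attached-between αa₁ αa₂ a₁≢a₂
    β-out : OutAmong β (edge (# 14)) (edge (# 15)) ⊎ OutAmong β (edge (# 16)) (edge (# 17))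
    β-out = attached-between βb₁ βb₂ b₁≢b₂
    α≢β : c α ≢ c β
    α≢β = blocked-bichromatic (edge-joins (# 5))
      (avoids₂ α-out edge≢ edge≢ edge≢ edge≢) (avoids₂ β-out edge≢ edge≢ edge≢ edge≢)
    γ-out : OutAmong γ (edge (# 4)) (edge (# 6))
    γ-out with one-of-two {z = c γ} α≢β
    ... | inj₁ γ≡α = inj₁ (forced-out (edge-joins (# 4)) γ≡α (avoids₂ α-out edge≢ edge≢ edge≢ edge≢))
    ... | inj₂ γ≡β = inj₂ (forced-out (swap (edge-joins (# 6))) γ≡β (avoids₂ β-out edge≢ edge≢ edge≢ edge≢))
    pair-bichromatic : ∀ {x} (P : Parallel H x γ) → Parallel.first P ≢ edge (# 4) → Parallel.first P ≢ edge (# 6) →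
      Parallel.second P ≢ edge (# 4) → Parallel.second P ≢ edge (# 6) → c x ≢ c γ
    pair-bichromatic P n₁ n₂ n₃ n₄ cx≡cγ =
      [ avoids γ-out n₁ n₂ , avoids γ-out n₃ n₄ ] (proj₂ (parallel-monochromatic P cx≡cγ))
    u≢γ : c u ≢ c γ
    u≢γ = pair-bichromatic uγ edge≢ edge≢ edge≢ edge≢
    w≢γ : c w ≢ c γ
    w≢γ = pair-bichromatic wγ edge≢ edge≢ edge≢ edge≢

  -- NE-gadget: the EQ-gadgets transport colours to the ends of a triple.
  ne-different-colours : ∀ {u w} → NEGadget H u w → c u ≢ c w
  ne-different-colours (ne eq-up pq eq-qw) cu≡cw =
    triple-bichromatic pq (trans (sym (eq-same-colour eq-up)) (trans cu≡cw (sym (eq-same-colour eq-qw))))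

-- The XO-gadget inside H.  Gadget vertices are numbered as in Defs:
-- 'v i' is the paper's v_i and 'vertex n' is vertex number n.
module XO (H : Multigraph) (G : XOIn H) where

  vertex : ℕ → Fin xoNV
  vertex n = n mod 150

  v : ℕ → Fin xoNV
  v i = vertex (V i)

  E : Fin xoNE → Fin (nE H)
  E = φE G

  E≢ : ∀ {g h} {g≢h : False (g Fin.≟ h)} → E g ≢ E h
  E≢ {g≢h = g≢h} = toWitnessFalse g≢h ∘ φE-inj G

  joins : ∀ g {i j} → xoEnds g ≡ (i , j) → Joins H (E g) (φV G i) (φV G j)
  joins g ends≡ = subst (λ ij → JoinsPair H (E g) (Product.map (φV G) (φV G) ij)) ends≡ (φ-ends G g)

  pair : ∀ g h {i j} → xoEnds g ≡ (i , j) → xoEnds h ≡ (i , j) → {g≢h : False (g Fin.≟ h)} →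
    Parallel H (φV G i) (φV G j)
  pair g h ends-g ends-h {g≢h} = parallel (E g) (E h) (joins g ends-g) (joins h ends-h) (E≢ {g≢h = g≢h})

  block : (k m : ℕ) → Fin 21 → Fin (k + (21 + m))
  block k m t = k ↑ʳ (t ↑ˡ m)

  block-injective : ∀ k m → Injective _≡_ _≡_ (block k m)
  block-injective k m eq = ↑ˡ-injective m _ _ (↑ʳ-injective k _ _ eq)

  eq-gadget : (u w b : ℕ) (g : Fin 21 → Fin xoNE) → Injective _≡_ _≡_ g →
    tabulate (xoEnds ∘ g) ≡ eqEdges (vertex u) (vertex w) (vertex b) (vertex (b + 1)) (vertex (b + 2))
                              (vertex (b + 3)) (vertex (b + 4)) (vertex (b + 5)) (vertex (b + 6)) →
    EQGadget H (φV G (vertex u)) (φV G (vertex w))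
  eq-gadget u w b g g-injective ends≡pattern = record
    { γ = φV G (vertex b) ; α = φV G (vertex (b + 1)) ; β = φV G (vertex (b + 2))
    ; a₁ = φV G (vertex (b + 3)) ; a₂ = φV G (vertex (b + 4))
    ; b₁ = φV G (vertex (b + 5)) ; b₂ = φV G (vertex (b + 6))
    ; edge           = E ∘ g
    ; edge-injective = g-injective ∘ φE-inj G
    ; edge-joins     = λ t → subst (JoinsPair H (E (g t))) (image t) (φ-ends G (g t))
    }
    where
    φ² : Fin xoNV × Fin xoNV → Fin (nV H) × Fin (nV H)
    φ² = Product.map (φV G) (φV G)
    gadgetEdges : Vec (Fin xoNV × Fin xoNV) 21
    gadgetEdges = eqEdges (vertex u) (vertex w) (vertex b) (vertex (b + 1)) (vertex (b + 2))
                          (vertex (b + 3)) (vertex (b + 4)) (vertex (b + 5)) (vertex (b + 6))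
    image : ∀ t → φ² (xoEnds (g t)) ≡ lookup (map φ² gadgetEdges) t
    image t = begin
      φ² (xoEnds (g t))                         ≡⟨ cong φ² (sym (lookup∘tabulate (xoEnds ∘ g) t)) ⟩
      φ² (lookup (tabulate (xoEnds ∘ g)) t)     ≡⟨ cong (λ es → φ² (lookup es t)) ends≡pattern ⟩
      φ² (lookup gadgetEdges t)                 ≡⟨ sym (lookup-map t φ² gadgetEdges) ⟩
      lookup (map φ² gadgetEdges) t             ∎
      where open ≡-Reasoning


  -- The EQ- and NE-gadgets of the XO-gadget used below, located by the
  -- position of their first edge in the edge list of Defs.
  EQ : ℕ → ℕ → Set
  EQ i j = EQGadget H (φV G (v i)) (φV G (v j))

  eq-1-2 : EQ 1 2
  eq-1-2 = eq-gadget (V 1) (V 2) (eqB 0) (block 0 387) (block-injective 0 387) refl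
  eq-2-3 : EQ 2 3
  eq-2-3 = eq-gadget (V 2) (V 3) (eqB 1) (block 21 366) (block-injective 21 366) refl
  eq-3-4 : EQ 3 4
  eq-3-4 = eq-gadget (V 3) (V 4) (eqB 2) (block 42 345) (block-injective 42 345) refl
  eq-2-14 : EQ 2 14
  eq-2-14 = eq-gadget (V 2) (V 14) (eqB 4) (block 137 250) (block-injective 137 250) refl
  eq-14-8 : EQ 14 8
  eq-14-8 = eq-gadget (V 14) (V 8) (eqB 5) (block 158 229) (block-injective 158 229) refl
  eq-4-13 : EQ 4 13
  eq-4-13 = eq-gadget (V 4) (V 13) (eqB 6) (block 224 163) (block-injective 224 163) refl
  eq-13-12 : EQ 13 12
  eq-13-12 = eq-gadget (V 13) (V 12) (eqB 7) (block 245 142) (block-injective 245 142) refl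
  eq-7-16 : EQ 7 16
  eq-7-16 = eq-gadget (V 7) (V 16) (eqB 8) (block 270 117) (block-injective 270 117) refl
  eq-6-15 : EQ 6 15
  eq-6-15 = eq-gadget (V 6) (V 15) (eqB 9) (block 295 92) (block-injective 295 92) refl
  eq-15-19 : EQ 15 19
  eq-15-19 = eq-gadget (V 15) (V 19) (eqB 10) (block 316 71) (block-injective 316 71) refl
  eq-11-18 : EQ 11 18
  eq-11-18 = eq-gadget (V 11) (V 18) (eqB 11) (block 339 48) (block-injective 339 48) refl
  eq-10-17 : EQ 10 17
  eq-10-17 = eq-gadget (V 10) (V 17) (eqB 12) (block 364 23) (block-injective 364 23) refl
  eq-17-20 : EQ 17 20
  eq-17-20 = eq-gadget (V 17) (V 20) (eqB 13) (block 385 2) (block-injective 385 2) refl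

  ne-1-6 : NEGadget H (φV G (v 1)) (φV G (v 6))
  ne-1-6 = ne (eq-gadget (V 1) (neB 0) (neB 0 + 2) (block 92 295) (block-injective 92 295) refl)
              (triple (pair (# 113) (# 114) refl refl) (E (# 115)) (joins (# 115) refl) E≢ E≢)
              (eq-gadget (neB 0 + 1) (V 6) (neB 0 + 9) (block 116 271) (block-injective 116 271) refl)
  ne-3-10 : NEGadget H (φV G (v 3)) (φV G (v 10))
  ne-3-10 = ne (eq-gadget (V 3) (neB 1) (neB 1 + 2) (block 179 208) (block-injective 179 208) refl)
               (triple (pair (# 200) (# 201) refl refl) (E (# 202)) (joins (# 202) refl) E≢ E≢)
               (eq-gadget (neB 1 + 1) (V 10) (neB 1 + 9) (block 203 184) (block-injective 203 184) refl)

module XOColouring (H : Multigraph) (G : XOIn H) (c : Coloring H) (o : Orientation H)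
  (out-unique : ∀ {v e e'} → DirectedAway H o v e → DirectedAway H o v e' → e ≡ e')
  (mono-directed : ∀ e → c (proj₁ (ends H e)) ≡ c (proj₂ (ends H e)) → IsDirected H o e)
  where

  open XO H G
  open Colouring H c o out-unique mono-directed

  col : ℕ → Bool
  col i = c (φV G (v i))

  v2∈A : col 2 ≡ col 1
  v2∈A = sym (eq-same-colour eq-1-2)
  v3∈A : col 3 ≡ col 1
  v3∈A = trans (sym (eq-same-colour eq-2-3)) v2∈A
  v4∈A : col 4 ≡ col 1
  v4∈A = trans (sym (eq-same-colour eq-3-4)) v3∈A
  v14∈A : col 14 ≡ col 1
  v14∈A = trans (sym (eq-same-colour eq-2-14)) v2∈A
  v8∈A : col 8 ≡ col 1
  v8∈A = trans (sym (eq-same-colour eq-14-8)) v14∈A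
  v13∈A : col 13 ≡ col 1
  v13∈A = trans (sym (eq-same-colour eq-4-13)) v4∈A
  v12∈A : col 12 ≡ col 1
  v12∈A = trans (sym (eq-same-colour eq-13-12)) v13∈A

  v6∉A : col 6 ≢ col 1
  v6∉A v6∈A = ne-different-colours ne-1-6 (sym v6∈A)
  v15∉A : col 15 ≢ col 1
  v15∉A v15∈A = v6∉A (trans (eq-same-colour eq-6-15) v15∈A)
  v19∉A : col 19 ≢ col 1
  v19∉A v19∈A = v15∉A (trans (eq-same-colour eq-15-19) v19∈A)
  v10∉A : col 10 ≢ col 1
  v10∉A v10∈A = ne-different-colours ne-3-10 (trans v3∈A (sym v10∈A))
  v17∉A : col 17 ≢ col 1
  v17∉A v17∈A = v10∉A (trans (eq-same-colour eq-10-17) v17∈A)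
  v20∉A : col 20 ≢ col 1
  v20∉A v20∈A = v17∉A (trans (eq-same-colour eq-17-20) v20∈A)

  y-terminals : col 19 ≡ col 20
  y-terminals = both-differ⇒equal v19∉A v20∉A

  -- v7 in the class, v11 not: the segment v8 v9 v10 v11 is blocked, since
  -- v8 ~ v16 and v11 ~ v20 are monochromatic pairs and v9 hangs between
  -- v14 and v17.
  right-blocked : col 7 ≡ col 1 → col 11 ≢ col 1 → ⊥
  right-blocked v7∈A v11∉A =
    blocked-segment (λ v8≡v10 → v10∉A (trans (sym v8≡v10) v8∈A)) (both-differ⇒equal v10∉A v11∉A)
      (joins (# 87) refl) (joins (# 88) refl) (joins (# 89) refl) E≢
      (avoids v8-out E≢ E≢) (avoids₂ v9-out E≢ E≢ E≢ E≢) (avoids₂ v9-out E≢ E≢ E≢ E≢) (avoids v11-out E≢ E≢)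
    where
    v16∈A : col 16 ≡ col 1
    v16∈A = trans (sym (eq-same-colour eq-7-16)) v7∈A
    v8-out : OutAmong (φV G (v 8)) (E (# 291)) (E (# 292))
    v8-out = proj₁ (parallel-monochromatic (pair (# 291) (# 292) refl refl) (trans v8∈A (sym v16∈A)))
    v11-out : OutAmong (φV G (v 11)) (E (# 362)) (E (# 363))
    v11-out = proj₁ (parallel-monochromatic (pair (# 362) (# 363) refl refl) (both-differ⇒equal v11∉A v20∉A))
    v9-out : OutAmong (φV G (v 9)) (E (# 268)) (E (# 269)) ⊎ OutAmong (φV G (v 9)) (E (# 406)) (E (# 407))
    v9-out = attached-between (parallel-sym (pair (# 268) (# 269) refl refl)) (pair (# 406) (# 407) refl refl)
               (λ v14≡v17 → v17∉A (trans (sym v14≡v17) v14∈A))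

  -- v11 in the class, v7 not: symmetrically the segment v12 v5 v6 v7 is
  -- blocked, via the pairs v12 ~ v18, v7 ~ v19 and v5 between v13 and v15.
  left-blocked : col 7 ≢ col 1 → col 11 ≡ col 1 → ⊥
  left-blocked v7∉A v11∈A =
    blocked-segment (λ v12≡v6 → v6∉A (trans (sym v12≡v6) v12∈A)) (both-differ⇒equal v6∉A v7∉A)
      (joins (# 91) refl) (joins (# 84) refl) (joins (# 85) refl) E≢
      (avoids v12-out E≢ E≢) (avoids₂ v5-out E≢ E≢ E≢ E≢) (avoids₂ v5-out E≢ E≢ E≢ E≢) (avoids v7-out E≢ E≢)
    where
    v18∈A : col 18 ≡ col 1
    v18∈A = trans (sym (eq-same-colour eq-11-18)) v11∈A
    v12-out : OutAmong (φV G (v 12)) (E (# 360)) (E (# 361))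
    v12-out = proj₁ (parallel-monochromatic (pair (# 360) (# 361) refl refl) (trans v12∈A (sym v18∈A)))
    v7-out : OutAmong (φV G (v 7)) (E (# 293)) (E (# 294))
    v7-out = proj₁ (parallel-monochromatic (pair (# 293) (# 294) refl refl) (both-differ⇒equal v7∉A v19∉A))
    v5-out : OutAmong (φV G (v 5)) (E (# 266)) (E (# 267)) ⊎ OutAmong (φV G (v 5)) (E (# 337)) (E (# 338))
    v5-out = attached-between (parallel-sym (pair (# 266) (# 267) refl refl)) (pair (# 337) (# 338) refl refl)
               (λ v13≡v15 → v15∉A (trans (sym v13≡v15) v13∈A))

  -- Exactly one of v7, v11 would lie in the class of v1; both cases are blocked.
  v7≡v11 : col 7 ≡ col 11
  v7≡v11 = decidable-stable (col 7 ≟ col 11) differ-impossible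
    where
    differ-impossible : col 7 ≢ col 11 → ⊥
    differ-impossible v7≢v11 with col 7 ≟ col 1
    ... | yes v7∈A = right-blocked v7∈A (λ v11∈A → v7≢v11 (trans v7∈A (sym v11∈A)))
    ... | no  v7∉A = left-blocked v7∉A (both-differ⇒equal (v7≢v11 ∘ sym) (v7∉A ∘ sym))

  x-terminals : col 16 ≡ col 18
  x-terminals = begin
    col 16 ≡⟨ sym (eq-same-colour eq-7-16) ⟩
    col 7  ≡⟨ v7≡v11 ⟩
    col 11 ≡⟨ eq-same-colour eq-11-18 ⟩
    col 18 ∎
    where open ≡-Reasoning

lemma10 : (H : Multigraph) (G : XOIn H) (c : Coloring H) → IsFO2Coloring H c →
    (c (φV G xoX) ≡ c (φV G xoX')) × (c (φV G xoY) ≡ c (φV G xoY'))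
lemma10 H G c (o , functional , mono-directed) = x-terminals , y-terminals
  where open XOColouring H G c o (functional⇒out-unique H o functional) mono-directed
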